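{- If $m\ge 2$ is even and $k\ge 1$, then $\textup{aw}(P_m\square C_{4k+2},3)=3$.
   Context: All graphs are finite, simple and undirected; $\textup{d}(u,v)$ denotes shortest-path distance. $P_m$ is the path on $m$ vertices and $C_n$ the cycle on $n$ vertices. The Cartesian product $G\square H$ has vertex set $V(G)\times V(H)$, with $(x,y)$ adjacent to $(x',y')$ iff either $x=x'$ and $yy'\in E(H)$, or $y=y'$ and $xx'\in E(G)$. A 3-term arithmetic progression (3-AP) is a set of vertices $\{v_1,v_2,v_3\}$ (listed in some order) with $\textup{d}(v_1,v_2)=\textup{d}(v_2,v_3)$. An exact $r$-coloring of a graph $G$ is a surjective map $c:V(G)\to\{1,\dots,r\}$; a set is rainbow under $c$ if its vertices receive pairwise distinct colors. $\textup{aw}(G,3)$ is the least positive integer $r$ such that every exact $r$-coloring of $G$ contains a rainbow 3-AP; if no coloring yields a rainbow 3-AP, then $\textup{aw}(G,3)=|V(G)|+1$. -}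

module Defs where

open import Data.Nat using (ℕ; zero; suc; _+_; _<_; _≤_; _%_)
open import Data.Fin using (Fin; toℕ)
open import Data.Product using (Σ; ∃; _×_; _,_)
open import Data.Sum using (_⊎_)
open import Relation.Nullary using (¬_)
open import Relation.Binary.PropositionalEquality using (_≡_; _≢_)

record Graph : Set₁ where
  field
    V   : Set
    Adj : V → V → Set

open Graph public

P : ℕ → Graph
P m = record { V = Fin m ; Adj = λ i j → (toℕ j ≡ suc (toℕ i)) ⊎ (toℕ i ≡ suc (toℕ j)) }

C : (n : ℕ) → Graph
C zero    = record { V = Fin zero ; Adj = λ _ _ → Fin zero }
C (suc n) = record { V = Fin (suc n)
                   ; Adj = λ i j → (toℕ j ≡ (suc (toℕ i)) % suc n)
                                 ⊎ (toℕ i ≡ (suc (toℕ j)) % suc n) }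

_□_ : Graph → Graph → Graph
G □ H = record
  { V   = V G × V H
  ; Adj = λ { (x , y) (x' , y') →
              (x ≡ x' × Adj H y y') ⊎ (y ≡ y' × Adj G x x') } }

data Walk (G : Graph) : V G → V G → ℕ → Set where
  here : ∀ {u} → Walk G u u zero
  step : ∀ {u w v ℓ} → Adj G u w → Walk G w v ℓ → Walk G u v (suc ℓ)

Dist : (G : Graph) → V G → V G → ℕ → Set
Dist G u v ℓ = Walk G u v ℓ × (∀ ℓ' → ℓ' < ℓ → ¬ Walk G u v ℓ')

Exact : (G : Graph) (r : ℕ) → (V G → Fin r) → Set
Exact G r c = ∀ (i : Fin r) → ∃ λ v → c v ≡ i

-- c contains a rainbow 3-AP: vertices v1,v2,v3 with d(v1,v2) = d(v2,v3)
-- and pairwise distinct colours (which forces the vertices to be distinct).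
HasRainbow3AP : (G : Graph) (r : ℕ) → (V G → Fin r) → Set
HasRainbow3AP G r c =
  Σ (V G) λ v₁ → Σ (V G) λ v₂ → Σ (V G) λ v₃ → Σ ℕ λ ℓ →
    Dist G v₁ v₂ ℓ × Dist G v₂ v₃ ℓ ×
    c v₁ ≢ c v₂ × c v₂ ≢ c v₃ × c v₁ ≢ c v₃

EveryExactRainbow : Graph → ℕ → Set
EveryExactRainbow G r = ∀ (c : V G → Fin r) → Exact G r c → HasRainbow3AP G r c

-- aw(G,3) = r : r is the least positive integer with EveryExactRainbow G r.
-- (For r = |V(G)|+1 there are no exact colorings, so the property holds vacuously;
--  this matches the convention aw = |V|+1 when no coloring gives a rainbow 3-AP.)
aw3≡ : Graph → ℕ → Set
aw3≡ G r = 1 ≤ r × EveryExactRainbow G r × (∀ s → 1 ≤ s → s < r → ¬ EveryExactRainbow G s)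

-- In P_m □ C_n the distance is |a − b| plus the cyclic distance of the columns.  Let a
-- 3-colouring have no rainbow 3-AP.  Any three corners of a unit square form a 3-AP, so a
-- square shows at most two colours.  A sequence of slots in which no two adjacent slots show
-- all three colours, but which uses all three, contains a gap: colours p and r in slots j and
-- j + H (H ≥ 2) with every slot strictly between showing only the third colour q.  Applied to
-- the columns of two adjacent rows this, together with an explicit 3-AP for every shape of
-- gap, shows that adjacent rows show at most two colours; applied once more to the rows it
-- leaves a gap of rows, and again an explicit 3-AP with colours p, q, r exists.  The explicit
-- 3-APs use that half the cycle, K = 2k + 1, is odd, and, for one shape of gap, that m is
-- even; so no surjective 3-colouring is rainbow-free, while fewer colours never give a
-- rainbow triple.

module Submission where

open import Defs
open import Data.Nat.Divisibility using (_∣_; divides)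
open import Data.Bool using (Bool; true; false)
open import Data.Empty using (⊥; ⊥-elim)
open import Data.Fin using (Fin; toℕ; fromℕ<)
open import Data.Fin.Patterns using (0F; 1F; 2F)
open import Data.Fin.Properties using (all?; any?; toℕ-fromℕ<; toℕ-injective; toℕ<n) renaming (_≟_ to _≟ᶠ_)
open import Data.Nat using (ℕ; zero; suc; _+_; _*_; _∸_; _⊓_; ∣_-_∣; _%_; _≤_; _<_; z≤n; s≤s; s≤s⁻¹; z<s; _<?_; _≤?_; NonZero)
open import Data.Nat.DivMod using (m<n⇒m%n≡m; m%n<n; m%n≤n; n%n≡0; m%n%n≡m%n; [m+n]%n≡m%n; %-distribˡ-+)
open import Data.Nat.Tactic.RingSolver using (solve-∀)
open import Data.Nat.Properties
open import Data.Product using (Σ; ∃; _×_; _,_; proj₁; proj₂)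
open import Data.Sum using (_⊎_; inj₁; inj₂; swap)
open import Relation.Binary.PropositionalEquality
open import Relation.Nullary using (¬_; Dec; yes; no)
open import Relation.Nullary.Decidable using (map′; decidable-stable; ¬?; _×-dec_; _⊎-dec_; _→-dec_; from-yes; ¬¬-excluded-middle)

Rainbow : {A : Set} → A → A → A → Set
Rainbow x y z = x ≢ y × y ≢ z × x ≢ z

module _ {A : Set} {x y z : A} where

  rainbow-swap₁₂ : Rainbow x y z → Rainbow y x z
  rainbow-swap₁₂ (x≢y , y≢z , x≢z) = ≢-sym x≢y , x≢z , y≢z

  rainbow-swap₂₃ : Rainbow x y z → Rainbow x z y
  rainbow-swap₂₃ (x≢y , y≢z , x≢z) = x≢z , ≢-sym y≢z , x≢y

  rainbow-rotate : Rainbow x y z → Rainbow y z x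
  rainbow-rotate (x≢y , y≢z , x≢z) = y≢z , ≢-sym x≢z , ≢-sym x≢y

  rainbow-reverse : Rainbow x y z → Rainbow z y x
  rainbow-reverse (x≢y , y≢z , x≢z) = ≢-sym y≢z , ≢-sym x≢y , ≢-sym x≢z

rainbow? : ∀ {r} (x y z : Fin r) → Dec (Rainbow x y z)
rainbow? x y z = ¬? (x ≟ᶠ y) ×-dec ¬? (y ≟ᶠ z) ×-dec ¬? (x ≟ᶠ z)

rainbow-covers : {x y z : Fin 3} → Rainbow x y z → ∀ c → c ≡ x ⊎ c ≡ y ⊎ c ≡ z
rainbow-covers {x} {y} {z} = from-yes
  (all? {n = 3} λ x → all? λ y → all? λ z → rainbow? x y z →-dec
     all? λ c → c ≟ᶠ x ⊎-dec c ≟ᶠ y ⊎-dec c ≟ᶠ z) x y z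

Among4 : Fin 3 → Fin 3 → Fin 3 → Fin 3 → Fin 3 → Set
Among4 w x y z c = (w ≡ c ⊎ x ≡ c) ⊎ (y ≡ c ⊎ z ≡ c)

no-rainbow-subtriple⇒dichromatic :
  (w x y z : Fin 3) → ¬ Rainbow w x y → ¬ Rainbow w x z → ¬ Rainbow w y z → ¬ Rainbow x y z →
  ∀ {c₁ c₂ c₃} → Rainbow c₁ c₂ c₃ → Among4 w x y z c₁ → Among4 w x y z c₂ → ¬ Among4 w x y z c₃
no-rainbow-subtriple⇒dichromatic w x y z ¬wxy ¬wxz ¬wyz ¬xyz {c₁} {c₂} {c₃} = from-yes
  (all? {n = 3} λ w → all? λ x → all? λ y → all? λ z →
     ¬? (rainbow? w x y) →-dec ¬? (rainbow? w x z) →-dec ¬? (rainbow? w y z) →-dec ¬? (rainbow? x y z) →-dec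
     all? λ c₁ → all? λ c₂ → all? λ c₃ →
       rainbow? c₁ c₂ c₃ →-dec among? w x y z c₁ →-dec among? w x y z c₂ →-dec ¬? (among? w x y z c₃))
  w x y z ¬wxy ¬wxz ¬wyz ¬xyz c₁ c₂ c₃
  where
    among? : (w x y z c : Fin 3) → Dec (Among4 w x y z c)
    among? w x y z c = (w ≟ᶠ c ⊎-dec x ≟ᶠ c) ⊎-dec (y ≟ᶠ c ⊎-dec z ≟ᶠ c)

no-rainbow-below-three : ∀ {s} → s < 3 → (x y z : Fin s) → ¬ Rainbow x y z
no-rainbow-below-three {1} _ = from-yes (all? {n = 1} λ x → all? λ y → all? λ z → ¬? (rainbow? x y z))
no-rainbow-below-three {2} _ = from-yes (all? {n = 2} λ x → all? λ y → all? λ z → ¬? (rainbow? x y z))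
no-rainbow-below-three {suc (suc (suc _))} (s≤s (s≤s (s≤s ())))

fewer-than-three-colours : ∀ G {s} → s < 3 → (c : V G → Fin s) → Exact G s c → ¬ EveryExactRainbow G s
fewer-than-three-colours G s<3 c onto every with every c onto
... | v₁ , v₂ , v₃ , _ , _ , _ , rainbow = no-rainbow-below-three s<3 (c v₁) (c v₂) (c v₃) rainbow

-- Gaps in coloured sequences

last-occurrence : ∀ {P : ℕ → Set} B → (∃ λ t → t < B × P t) →
                  ¬ ¬ (∃ λ j → j < B × P j × (∀ t → j < t → t < B → ¬ P t))
last-occurrence zero (_ , () , _)
last-occurrence {P} (suc B) (t , t<1+B , Pt) ¬last = ¬¬-excluded-middle λ where
    (yes PB) → ¬last (B , ≤-refl , PB , λ u B<u u<1+B → ⊥-elim (<⇒≱ B<u (s≤s⁻¹ u<1+B)))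
    (no ¬PB) → last-occurrence B (t , below ¬PB t<1+B Pt , Pt) λ where
      (j , j<B , Pj , after) → ¬last (j , m<n⇒m<1+n j<B , Pj , after′ ¬PB after)
  where
    below : ¬ P B → ∀ {u} → u < suc B → P u → u < B
    below ¬PB u<1+B Pu with m<1+n⇒m<n∨m≡n u<1+B
    ... | inj₁ u<B = u<B
    ... | inj₂ refl = ⊥-elim (¬PB Pu)
    after′ : ¬ P B → ∀ {j} → (∀ u → j < u → u < B → ¬ P u) → ∀ u → j < u → u < suc B → ¬ P u
    after′ ¬PB after u j<u u<1+B with m<1+n⇒m<n∨m≡n u<1+B
    ... | inj₁ u<B = after u j<u u<B
    ... | inj₂ refl = ¬PB

module Gaps (S : ℕ → Fin 3 → Set) where

  SeenBelow : ℕ → Fin 3 → Set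
  SeenBelow B c = ∃ λ t → t < B × S t c

  InPair : ℕ → Fin 3 → Set
  InPair t c = S t c ⊎ S (suc t) c

  record Gap (L : ℕ) : Set where
    field
      start width : ℕ
      left middle right : Fin 3
      rainbow : Rainbow left middle right
      wide : 2 ≤ width
      fits : start + width < L
      at-start : S start left
      at-end : S (start + width) right
      inside : ∀ t c → start < t → t < start + width → S t c → c ≡ middle

  gap-before-first-sight : ∀ {L B a d z} → suc B < L → Rainbow a d z → ¬ SeenBelow (suc B) z → S (suc B) z →
                           ¬ InPair B a → SeenBelow (suc (suc B)) a → ¬ ¬ Gap L
  gap-before-first-sight {L} {B} {a} {d} {z} B+1<L adz unseen Sz a∉pair (t , t<B+2 , Sa) ¬gap =
    last-occurrence B (t , t<B , Sa) λ (j , j<B , Sj , after) → ¬gap (gap j j<B Sj after)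
    where
      t<B : t < B
      t<B with m<1+n⇒m<n∨m≡n t<B+2
      ... | inj₂ refl = ⊥-elim (a∉pair (inj₂ Sa))
      ... | inj₁ t<B+1 with m<1+n⇒m<n∨m≡n t<B+1
      ...   | inj₁ t<B = t<B
      ...   | inj₂ refl = ⊥-elim (a∉pair (inj₁ Sa))

      gap : ∀ j → j < B → S j a → (∀ u → j < u → u < B → ¬ S u a) → Gap L
      gap j j<B Sj after = record
        { start = j ; width = suc B ∸ j ; left = a ; middle = d ; right = z ; rainbow = adz
        ; wide = m+n≤o⇒m≤o∸n 2 (s≤s j<B)
        ; fits = subst (_< L) (sym end≡) B+1<L
        ; at-start = Sj
        ; at-end = subst (λ u → S u z) (sym end≡) Sz
        ; inside = λ u c j<u u<end → only-d u c j<u (subst (u <_) end≡ u<end) }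
        where
          end≡ : j + (suc B ∸ j) ≡ suc B
          end≡ = m+[n∸m]≡n (<⇒≤ (m<n⇒m<1+n j<B))

          only-d : ∀ u c → j < u → u < suc B → S u c → c ≡ d
          only-d u c j<u u<B+1 Sc with rainbow-covers adz c
          ... | inj₂ (inj₁ c≡d) = c≡d
          ... | inj₂ (inj₂ refl) = ⊥-elim (unseen (u , u<B+1 , Sc))
          ... | inj₁ refl with m<1+n⇒m<n∨m≡n u<B+1
          ...   | inj₁ u<B = ⊥-elim (after u j<u u<B Sc)
          ...   | inj₂ refl = ⊥-elim (a∉pair (inj₁ Sc))

  module _ (L : ℕ) (2≤L : 2 ≤ L) (nonempty : ∀ t → suc t < L → ∃ (S t))
           (pairs-not-rainbow : ∀ t → suc t < L → ∀ {x y z} → Rainbow x y z → InPair t x → InPair t y → ¬ InPair t z) where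

    -- z is first seen in slot B; the slot before B shows a colour d ≠ z, and the third colour starts the gap
    gap-at-first-sight : ∀ B → B < L → ∀ {x y z} → Rainbow x y z → ¬ SeenBelow B z → S B z →
                         SeenBelow (suc B) x → SeenBelow (suc B) y → ¬ ¬ Gap L
    gap-at-first-sight zero _ xyz _ Sz (zero , _ , Sx) (zero , _ , Sy) _ =
      pairs-not-rainbow 0 2≤L xyz (inj₁ Sx) (inj₁ Sy) (inj₁ Sz)
    gap-at-first-sight zero _ _ _ _ (suc _ , s≤s () , _) _ _
    gap-at-first-sight zero _ _ _ _ _ (suc _ , s≤s () , _) _
    gap-at-first-sight (suc B) B+1<L xyz unseen Sz seen-x seen-y with nonempty B B+1<L
    ... | d , Sd with rainbow-covers xyz d
    ...   | inj₁ refl =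
            gap-before-first-sight B+1<L yxz unseen Sz (λ Py → pairs-not-rainbow B B+1<L yxz Py (inj₁ Sd) (inj₂ Sz)) seen-y
      where yxz = rainbow-swap₁₂ xyz
    ...   | inj₂ (inj₁ refl) =
            gap-before-first-sight B+1<L xyz unseen Sz (λ Px → pairs-not-rainbow B B+1<L xyz Px (inj₁ Sd) (inj₂ Sz)) seen-x
    ...   | inj₂ (inj₂ refl) = λ _ → unseen (B , ≤-refl , Sd)

    newest : ∀ {B c} → SeenBelow (suc B) c → ¬ SeenBelow B c → S B c
    newest (t , t<B+1 , Sc) unseen with m<1+n⇒m<n∨m≡n t<B+1
    ... | inj₁ t<B = ⊥-elim (unseen (t , t<B , Sc))
    ... | inj₂ refl = Sc

    gap-below : ∀ B → B ≤ L → ∀ {x y z} → Rainbow x y z →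
                SeenBelow B x → SeenBelow B y → SeenBelow B z → ¬ ¬ Gap L
    gap-below zero _ _ (_ , () , _) _ _
    gap-below (suc B) B<L xyz sx sy sz ¬gap = ¬¬-excluded-middle λ where
      (no ¬x) → gap-at-first-sight B B<L (rainbow-rotate xyz) ¬x (newest sx ¬x) sy sz ¬gap
      (yes sx′) → ¬¬-excluded-middle λ where
        (no ¬y) → gap-at-first-sight B B<L (rainbow-swap₂₃ xyz) ¬y (newest sy ¬y) sx sz ¬gap
        (yes sy′) → ¬¬-excluded-middle λ where
          (no ¬z) → gap-at-first-sight B B<L xyz ¬z (newest sz ¬z) sx sy ¬gap
          (yes sz′) → gap-below B (<⇒≤ B<L) xyz sx′ sy′ sz′ ¬gap

    rainbow-sequence-has-gap : ∀ {x y z} → Rainbow x y z → SeenBelow L x → SeenBelow L y → SeenBelow L z → ¬ ¬ Gap L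
    rainbow-sequence-has-gap = gap-below L ≤-refl

∣n-d+n∣≡d : ∀ d a → ∣ a - d + a ∣ ≡ d
∣n-d+n∣≡d d a = trans (cong (∣ a -_∣) (+-comm d a)) (∣m-m+n∣≡n a d)

Consecutive : ℕ → ℕ → Set
Consecutive a a′ = a′ ≡ suc a ⊎ a ≡ suc a′

∣-∣-consecutive : ∀ {a a′} b → Consecutive a a′ → ∣ a - b ∣ ≤ suc ∣ a′ - b ∣
∣-∣-consecutive {a} {a′} b aa′ = ≤-trans (∣-∣-triangle a a′ b) (+-monoˡ-≤ ∣ a′ - b ∣ (one-apart aa′))
  where
    one-apart : Consecutive a a′ → ∣ a - a′ ∣ ≤ 1
    one-apart (inj₁ refl) = ≤-reflexive (∣n-d+n∣≡d 1 a)
    one-apart (inj₂ refl) = ≤-reflexive (trans (∣-∣-comm (suc a′) a′) (∣n-d+n∣≡d 1 a′))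

∸-step : ∀ N d d′ → d′ ≤ suc d → N ∸ d ≤ suc (N ∸ d′)
∸-step N zero zero _ = n≤1+n N
∸-step N zero (suc zero) _ = m≤n+m∸n N 1
∸-step N zero (suc (suc _)) (s≤s ())
∸-step zero (suc d) d′ _ = z≤n
∸-step (suc N) (suc d) zero _ = ≤-trans (m∸n≤m N d) (≤-trans (n≤1+n N) (n≤1+n (suc N)))
∸-step (suc N) (suc d) (suc d′) (s≤s d′≤1+d) = ∸-step N d d′ d′≤1+d

∣-∣-balance : ∀ a a′ s s′ → a + s ≡ a′ + s′ → ∣ a - a′ ∣ ≡ ∣ s′ - s ∣
∣-∣-balance zero a′ _ s′ refl = sym (∣n-d+n∣≡d a′ s′)
∣-∣-balance (suc a) zero s _ refl = sym (trans (∣-∣-comm (suc a + s) s) (∣n-d+n∣≡d (suc a) s))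
∣-∣-balance (suc a) (suc a′) s s′ e = ∣-∣-balance a a′ s s′ (suc-injective e)

EvenOrOdd : ℕ → Set
EvenOrOdd h = (∃ λ s → h ≡ s + s) ⊎ (∃ λ s → h ≡ suc (s + s))

even-or-odd : ∀ h → EvenOrOdd h
even-or-odd zero = inj₁ (0 , refl)
even-or-odd (suc h) with even-or-odd h
... | inj₁ (s , h≡) = inj₂ (s , cong suc h≡)
... | inj₂ (s , h≡) = inj₁ (suc s , trans (cong suc h≡) (cong suc (sym (+-suc s s))))

s+s≢1+t+t : ∀ s t → s + s ≢ suc (t + t)
s+s≢1+t+t s t e = even≢odd s t (trans (cong (s +_) (+-identityʳ s)) (trans e (cong (λ u → suc (t + u)) (sym (+-identityʳ t)))))

half-pos : ∀ {s} → 0 < s + s → 0 < s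
half-pos {suc s} _ = z<s

-- Walks and distances in C_n and P_m □ C_n

module _ {G : Graph} where

  _++ʷ_ : ∀ {u v w ℓ ℓ′} → Walk G u v ℓ → Walk G v w ℓ′ → Walk G u w (ℓ + ℓ′)
  here ++ʷ q = q
  step a p ++ʷ q = step a (p ++ʷ q)

  shorter : ∀ {u v ℓ ℓ′} → Walk G u v ℓ → Walk G u v ℓ′ → Walk G u v (ℓ ⊓ ℓ′)
  shorter {ℓ = ℓ} {ℓ′} p q with ≤-total ℓ ℓ′
  ... | inj₁ ℓ≤ℓ′ = subst (Walk G _ _) (sym (m≤n⇒m⊓n≡m ℓ≤ℓ′)) p
  ... | inj₂ ℓ′≤ℓ = subst (Walk G _ _) (sym (m≥n⇒m⊓n≡n ℓ′≤ℓ)) q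

  reverse : (∀ {u v} → Adj G u v → Adj G v u) → ∀ {u v ℓ} → Walk G u v ℓ → Walk G v u ℓ
  reverse Adj-sym here = here
  reverse Adj-sym {ℓ = suc ℓ} (step a p) =
    subst (Walk G _ _) (+-comm ℓ 1) (reverse Adj-sym p ++ʷ step (Adj-sym a) here)

module CycleDistance (n₀ : ℕ) where

  n : ℕ
  n = suc n₀

  cycleDist : ℕ → ℕ → ℕ
  cycleDist u v = ∣ u - v ∣ ⊓ (n ∸ ∣ u - v ∣)

  cycleDist-sym : ∀ u v → cycleDist u v ≡ cycleDist v u
  cycleDist-sym u v rewrite ∣-∣-comm u v = refl

  min-step : ∀ d d′ → d ≤ suc d′ → d′ ≤ suc d → d ⊓ (n ∸ d) ≤ suc (d′ ⊓ (n ∸ d′))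
  min-step d d′ d≤ d′≤ = ≤-trans (⊓-mono-≤ d≤ (∸-step n d d′ d′≤)) (≤-reflexive (sym (+-distribˡ-⊓ 1 d′ (n ∸ d′))))

  cycleDist-consecutive : ∀ {u u′} v → Consecutive u u′ → cycleDist u v ≤ suc (cycleDist u′ v)
  cycleDist-consecutive v uu′ = min-step _ _ (∣-∣-consecutive v uu′) (∣-∣-consecutive v (swap uu′))

  cycleDist-from-n₀ : ∀ v → v ≤ n₀ → cycleDist n₀ v ≡ (n₀ ∸ v) ⊓ suc v
  cycleDist-from-n₀ v v≤n₀ rewrite m≤n⇒∣n-m∣≡n∸m v≤n₀ | +-∸-assoc 1 (m∸n≤m n₀ v) | m∸[m∸n]≡n v≤n₀ = refl

  cycleDist-from-0 : ∀ v → v ≤ n₀ → cycleDist 0 v ≡ v ⊓ suc (n₀ ∸ v)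
  cycleDist-from-0 v v≤n₀ = cong (v ⊓_) (+-∸-assoc 1 v≤n₀)

  -- across the seam between n₀ and 0 the two arcs of the cycle exchange roles
  cycleDist-seam : ∀ v → v ≤ n₀ → cycleDist n₀ v ≤ suc (cycleDist 0 v) × cycleDist 0 v ≤ suc (cycleDist n₀ v)
  cycleDist-seam v v≤n₀ rewrite cycleDist-from-n₀ v v≤n₀ | cycleDist-from-0 v v≤n₀ =
    swap-min (n₀ ∸ v) v , swap-min v (n₀ ∸ v)
    where
      swap-min : ∀ A B → A ⊓ suc B ≤ suc (B ⊓ suc A)
      swap-min A B = ≤-trans (⊓-mono-≤ (≤-trans (n≤1+n A) (n≤1+n (suc A))) ≤-refl)
                             (≤-reflexive (⊓-comm (suc (suc A)) (suc B)))

  suc-mod : ∀ u → u < n → suc u % n ≡ suc u ⊎ (suc u % n ≡ 0 × u ≡ n₀)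
  suc-mod u u<n with suc u <? n
  ... | yes u+1<n = inj₁ (m<n⇒m%n≡m u+1<n)
  ... | no u+1≮n = inj₂ (trans (cong (_% n) u+1≡n) (n%n≡0 n) , suc-injective u+1≡n)
    where
      u+1≡n : suc u ≡ n
      u+1≡n = ≤-antisym u<n (≮⇒≥ u+1≮n)

  cycleDist-edge : ∀ {x x′ : Fin n} (y : Fin n) → Adj (C n) x x′ → cycleDist (toℕ x) (toℕ y) ≤ suc (cycleDist (toℕ x′) (toℕ y))
  cycleDist-edge {x} {x′} y (inj₁ x′≡) with suc-mod (toℕ x) (toℕ<n x)
  ... | inj₁ e = cycleDist-consecutive (toℕ y) (inj₁ (trans x′≡ e))
  ... | inj₂ (e , x≡n₀) rewrite trans x′≡ e | x≡n₀ = proj₁ (cycleDist-seam (toℕ y) (s≤s⁻¹ (toℕ<n y)))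
  cycleDist-edge {x} {x′} y (inj₂ x≡) with suc-mod (toℕ x′) (toℕ<n x′)
  ... | inj₁ e = cycleDist-consecutive (toℕ y) (inj₂ (trans x≡ e))
  ... | inj₂ (e , x′≡n₀) rewrite trans x≡ e | x′≡n₀ = proj₂ (cycleDist-seam (toℕ y) (s≤s⁻¹ (toℕ<n y)))

  +-%-absorbʳ : ∀ s t → (s + t % n) % n ≡ (s + t) % n
  +-%-absorbʳ s t = begin
    (s + t % n) % n           ≡⟨ %-distribˡ-+ s (t % n) n ⟩
    (s % n + t % n % n) % n   ≡⟨ cong (λ r → (s % n + r) % n) (m%n%n≡m%n t n) ⟩
    (s % n + t % n) % n       ≡⟨ %-distribˡ-+ s t n ⟨
    (s + t) % n               ∎
    where open ≡-Reasoning

  +-%-absorbˡ : ∀ s t → (s % n + t) % n ≡ (s + t) % n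
  +-%-absorbˡ s t = begin
    (s % n + t) % n   ≡⟨ cong (_% n) (+-comm (s % n) t) ⟩
    (t + s % n) % n   ≡⟨ +-%-absorbʳ t s ⟩
    (t + s) % n       ≡⟨ cong (_% n) (+-comm t s) ⟩
    (s + t) % n       ∎
    where open ≡-Reasoning

  forward-walk : ∀ s (x y : Fin n) → toℕ y ≡ (s + toℕ x) % n → Walk (C n) x y s
  forward-walk zero x y y≡ = subst (λ w → Walk (C n) x w 0) (toℕ-injective (sym (trans y≡ (m<n⇒m%n≡m (toℕ<n x))))) here
  forward-walk (suc s) x y y≡ = step (inj₁ (toℕ-fromℕ< next<n)) (forward-walk s (fromℕ< next<n) y y≡′)
    where
      next<n : suc (toℕ x) % n < n
      next<n = m%n<n (suc (toℕ x)) n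
      y≡′ : toℕ y ≡ (s + toℕ (fromℕ< next<n)) % n
      y≡′ = begin
        toℕ y                                ≡⟨ y≡ ⟩
        (suc s + toℕ x) % n                  ≡⟨ cong (_% n) (+-suc s (toℕ x)) ⟨
        (s + suc (toℕ x)) % n                ≡⟨ +-%-absorbʳ s (suc (toℕ x)) ⟨
        (s + suc (toℕ x) % n) % n            ≡⟨ cong (λ r → (s + r) % n) (toℕ-fromℕ< next<n) ⟨
        (s + toℕ (fromℕ< next<n)) % n        ∎
        where open ≡-Reasoning

  cycle-walk-≤ : ∀ (x y : Fin n) → toℕ x ≤ toℕ y → Walk (C n) x y (cycleDist (toℕ x) (toℕ y))
  cycle-walk-≤ x y x≤y =
    subst (Walk (C n) x y) (cong (λ e → e ⊓ (n ∸ e)) (sym (m≤n⇒∣m-n∣≡n∸m x≤y)))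
          (shorter (forward-walk d x y clockwise) (reverse swap (forward-walk (n ∸ d) y x anticlockwise)))
    where
      d = toℕ y ∸ toℕ x
      d≤n : d ≤ n
      d≤n = ≤-trans (m∸n≤m (toℕ y) (toℕ x)) (<⇒≤ (toℕ<n y))
      clockwise : toℕ y ≡ (d + toℕ x) % n
      clockwise = sym (trans (cong (_% n) (m∸n+n≡m x≤y)) (m<n⇒m%n≡m (toℕ<n y)))
      anticlockwise : toℕ x ≡ (n ∸ d + toℕ y) % n
      anticlockwise = sym (begin
        (n ∸ d + toℕ y) % n            ≡⟨ cong (λ r → (n ∸ d + r) % n) (m∸n+n≡m x≤y) ⟨
        (n ∸ d + (d + toℕ x)) % n      ≡⟨ cong (_% n) (+-assoc (n ∸ d) d (toℕ x)) ⟨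
        (n ∸ d + d + toℕ x) % n        ≡⟨ cong (λ r → (r + toℕ x) % n) (m∸n+n≡m d≤n) ⟩
        (n + toℕ x) % n                ≡⟨ cong (_% n) (+-comm n (toℕ x)) ⟩
        (toℕ x + n) % n                ≡⟨ [m+n]%n≡m%n (toℕ x) n ⟩
        toℕ x % n                      ≡⟨ m<n⇒m%n≡m (toℕ<n x) ⟩
        toℕ x                          ∎)
        where open ≡-Reasoning

  cycle-walk : ∀ (x y : Fin n) → Walk (C n) x y (cycleDist (toℕ x) (toℕ y))
  cycle-walk x y with ≤-total (toℕ x) (toℕ y)
  ... | inj₁ x≤y = cycle-walk-≤ x y x≤y
  ... | inj₂ y≤x = subst (Walk (C n) x y) (cycleDist-sym (toℕ y) (toℕ x)) (reverse swap (cycle-walk-≤ y x y≤x))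

  ‖_‖ : ℕ → ℕ
  ‖ t ‖ = cycleDist 0 (t % n)

  cycleDist-shift : ∀ u r → u < n → r ≤ n → cycleDist u ((u + r) % n) ≡ r ⊓ (n ∸ r)
  cycleDist-shift u r u<n r≤n with u + r <? n
  ... | yes u+r<n rewrite m<n⇒m%n≡m u+r<n = cong (λ d → d ⊓ (n ∸ d)) (∣m-m+n∣≡n u r)
  ... | no u+r≮n = begin
      cycleDist u ((u + r) % n)   ≡⟨ cong (cycleDist u) wrapped ⟩
      cycleDist u w               ≡⟨ cong (λ d → d ⊓ (n ∸ d)) ∣u-w∣≡n∸r ⟩
      (n ∸ r) ⊓ (n ∸ (n ∸ r))     ≡⟨ cong ((n ∸ r) ⊓_) (m∸[m∸n]≡n r≤n) ⟩
      (n ∸ r) ⊓ r                 ≡⟨ ⊓-comm (n ∸ r) r ⟩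
      r ⊓ (n ∸ r)                 ∎
    where
      open ≡-Reasoning
      w = u + r ∸ n
      n≤u+r : n ≤ u + r
      n≤u+r = ≮⇒≥ u+r≮n
      wrapped : (u + r) % n ≡ w
      wrapped = begin
        (u + r) % n         ≡⟨ cong (_% n) (m∸n+n≡m n≤u+r) ⟨
        (w + n) % n         ≡⟨ [m+n]%n≡m%n w n ⟩
        w % n               ≡⟨ m<n⇒m%n≡m (m<n+o⇒m∸n<o (u + r) n (+-mono-<-≤ u<n r≤n)) ⟩
        w                   ∎
      ∣u-w∣≡n∸r : ∣ u - w ∣ ≡ n ∸ r
      ∣u-w∣≡n∸r = trans (∣-∣-balance u w r n (sym (m∸n+n≡m n≤u+r))) (m≤n⇒∣n-m∣≡n∸m r≤n)

  cycleDist-translate : ∀ x t → cycleDist (x % n) ((x + t) % n) ≡ ‖ t ‖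
  cycleDist-translate x t =
    trans (cong (cycleDist (x % n)) (%-distribˡ-+ x t n)) (cycleDist-shift (x % n) (t % n) (m%n<n x n) (m%n≤n t n))

  cycleDist-offsets-≤ : ∀ x {s s′} → s ≤ s′ → cycleDist ((x + s) % n) ((x + s′) % n) ≡ ‖ ∣ s - s′ ∣ ‖
  cycleDist-offsets-≤ x {s} {s′} s≤s′ = begin
    cycleDist ((x + s) % n) ((x + s′) % n)               ≡⟨ cong (λ y → cycleDist ((x + s) % n) (y % n)) x+s′≡ ⟨
    cycleDist ((x + s) % n) ((x + s + (s′ ∸ s)) % n)     ≡⟨ cycleDist-translate (x + s) (s′ ∸ s) ⟩
    ‖ s′ ∸ s ‖                                           ≡⟨ cong ‖_‖ (m≤n⇒∣m-n∣≡n∸m s≤s′) ⟨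
    ‖ ∣ s - s′ ∣ ‖                                       ∎
    where
      open ≡-Reasoning
      x+s′≡ : x + s + (s′ ∸ s) ≡ x + s′
      x+s′≡ = trans (+-assoc x s (s′ ∸ s)) (cong (x +_) (m+[n∸m]≡n s≤s′))

  cycleDist-offsets : ∀ x s s′ → cycleDist ((x + s) % n) ((x + s′) % n) ≡ ‖ ∣ s - s′ ∣ ‖
  cycleDist-offsets x s s′ with ≤-total s s′
  ... | inj₁ s≤s′ = cycleDist-offsets-≤ x s≤s′
  ... | inj₂ s′≤s = begin
      cycleDist ((x + s) % n) ((x + s′) % n)   ≡⟨ cycleDist-sym ((x + s) % n) ((x + s′) % n) ⟩
      cycleDist ((x + s′) % n) ((x + s) % n)   ≡⟨ cycleDist-offsets-≤ x s′≤s ⟩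
      ‖ ∣ s′ - s ∣ ‖                           ≡⟨ cong ‖_‖ (∣-∣-comm s′ s) ⟩
      ‖ ∣ s - s′ ∣ ‖                           ∎
    where open ≡-Reasoning

  offset-to : ∀ x y → ∃ λ o → o ≤ n × (x + o) % n ≡ y % n
  offset-to x y with ≤-total (x % n) (y % n)
  ... | inj₁ u≤v = y % n ∸ x % n , ≤-trans (m∸n≤m (y % n) (x % n)) (m%n≤n y n) , (begin
      (x + (y % n ∸ x % n)) % n           ≡⟨ +-%-absorbˡ x (y % n ∸ x % n) ⟨
      (x % n + (y % n ∸ x % n)) % n       ≡⟨ cong (_% n) (m+[n∸m]≡n u≤v) ⟩
      y % n % n                           ≡⟨ m%n%n≡m%n y n ⟩
      y % n                               ∎)
    where open ≡-Reasoning
  ... | inj₂ v≤u = n ∸ d , m∸n≤m n d , (begin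
      (x + (n ∸ d)) % n                   ≡⟨ +-%-absorbˡ x (n ∸ d) ⟨
      (x % n + (n ∸ d)) % n               ≡⟨ cong (λ u → (u + (n ∸ d)) % n) (m+[n∸m]≡n v≤u) ⟨
      (y % n + d + (n ∸ d)) % n           ≡⟨ cong (_% n) (+-assoc (y % n) d (n ∸ d)) ⟩
      (y % n + (d + (n ∸ d))) % n         ≡⟨ cong (λ u → (y % n + u) % n) (m+[n∸m]≡n d≤n) ⟩
      (y % n + n) % n                     ≡⟨ [m+n]%n≡m%n (y % n) n ⟩
      y % n % n                           ≡⟨ m%n%n≡m%n y n ⟩
      y % n                               ∎)
    where
      open ≡-Reasoning
      d = x % n ∸ y % n
      d≤n : d ≤ n
      d≤n = ≤-trans (m∸n≤m (x % n) (y % n)) (m%n≤n x n)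

  shift : Bool → ℕ → ℕ
  shift true s = s
  shift false s = n ∸ s

  ∣shift-shift∣ : ∀ σ {s s′} → s ≤ n → s′ ≤ n → ∣ shift σ s - shift σ s′ ∣ ≡ ∣ s - s′ ∣
  ∣shift-shift∣ true _ _ = refl
  ∣shift-shift∣ false {s} {s′} s≤n s′≤n =
    trans (∣-∣-balance (n ∸ s) (n ∸ s′) s s′ (trans (m∸n+n≡m s≤n) (sym (m∸n+n≡m s′≤n)))) (∣-∣-comm s′ s)

module CylinderDistance (m n₀ : ℕ) where

  open CycleDistance n₀

  Cyl : Graph
  Cyl = P m □ C n

  cylinderDist : V Cyl → V Cyl → ℕ
  cylinderDist (a , x) (b , y) = ∣ toℕ a - toℕ b ∣ + cycleDist (toℕ x) (toℕ y)

  cylinderDist-edge : ∀ {u w} v → Adj Cyl u w → cylinderDist u v ≤ suc (cylinderDist w v)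
  cylinderDist-edge {a , x} {_ , x′} (b , y) (inj₁ (refl , xx′)) =
    ≤-trans (+-monoʳ-≤ ∣ toℕ a - toℕ b ∣ (cycleDist-edge y xx′)) (≤-reflexive (+-suc _ _))
  cylinderDist-edge {a , x} {a′ , _} (b , y) (inj₂ (refl , aa′)) =
    +-monoˡ-≤ (cycleDist (toℕ x) (toℕ y)) (∣-∣-consecutive (toℕ b) aa′)

  cylinderDist-self : ∀ u → cylinderDist u u ≡ 0
  cylinderDist-self (a , x) rewrite ∣n-n∣≡0 (toℕ a) | ∣n-n∣≡0 (toℕ x) = refl

  walk-length-≥ : ∀ {u v ℓ} → Walk Cyl u v ℓ → cylinderDist u v ≤ ℓ
  walk-length-≥ {u} here = ≤-reflexive (cylinderDist-self u)
  walk-length-≥ {u} {v} (step a p) = ≤-trans (cylinderDist-edge v a) (s≤s (walk-length-≥ p))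

  path-walk-up : ∀ d (a b : Fin m) → toℕ b ≡ d + toℕ a → Walk (P m) a b d
  path-walk-up zero a b b≡a = subst (λ w → Walk (P m) a w 0) (toℕ-injective (sym b≡a)) here
  path-walk-up (suc d) a b b≡ = step (inj₁ (toℕ-fromℕ< a+1<m)) (path-walk-up d (fromℕ< a+1<m) b b≡′)
    where
      a+1<m : suc (toℕ a) < m
      a+1<m = ≤-<-trans (≤-trans (s≤s (m≤n+m (toℕ a) d)) (≤-reflexive (sym b≡))) (toℕ<n b)
      b≡′ : toℕ b ≡ d + toℕ (fromℕ< a+1<m)
      b≡′ = trans b≡ (trans (sym (+-suc d (toℕ a))) (cong (d +_) (sym (toℕ-fromℕ< a+1<m))))

  path-walk : ∀ (a b : Fin m) → Walk (P m) a b ∣ toℕ a - toℕ b ∣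
  path-walk a b with ≤-total (toℕ a) (toℕ b)
  ... | inj₁ a≤b = subst (Walk (P m) a b) (sym (m≤n⇒∣m-n∣≡n∸m a≤b)) (path-walk-up _ a b (sym (m∸n+n≡m a≤b)))
  ... | inj₂ b≤a = subst (Walk (P m) a b) (sym (m≤n⇒∣n-m∣≡n∸m b≤a))
                         (reverse swap (path-walk-up _ b a (sym (m∸n+n≡m b≤a))))

  along-column : ∀ x {a b ℓ} → Walk (P m) a b ℓ → Walk Cyl (a , x) (b , x) ℓ
  along-column x here = here
  along-column x (step e p) = step (inj₂ (refl , e)) (along-column x p)

  along-row : ∀ a {x y ℓ} → Walk (C n) x y ℓ → Walk Cyl (a , x) (a , y) ℓ
  along-row a here = here
  along-row a (step e p) = step (inj₁ (refl , e)) (along-row a p)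

  cylinder-distance : ∀ u v → Dist Cyl u v (cylinderDist u v)
  cylinder-distance (a , x) (b , y) =
    along-column x (path-walk a b) ++ʷ along-row b (cycle-walk x y) ,
    λ ℓ ℓ< p → <⇒≱ ℓ< (walk-length-≥ p)

  RainbowAP : (V Cyl → Fin 3) → Set
  RainbowAP c = Σ (V Cyl) λ v₁ → Σ (V Cyl) λ v₂ → Σ (V Cyl) λ v₃ →
                cylinderDist v₁ v₂ ≡ cylinderDist v₂ v₃ × Rainbow (c v₁) (c v₂) (c v₃)

  any-vertex? : {Q : V Cyl → Set} → (∀ v → Dec (Q v)) → Dec (Σ (V Cyl) Q)
  any-vertex? Q? = map′ (λ (a , x , q) → (a , x) , q) (λ ((a , x) , q) → a , x , q) (any? λ a → any? λ x → Q? (a , x))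

  rainbowAP? : (c : V Cyl → Fin 3) → Dec (RainbowAP c)
  rainbowAP? c = any-vertex? λ v₁ → any-vertex? λ v₂ → any-vertex? λ v₃ →
                 (cylinderDist v₁ v₂ ≟ cylinderDist v₂ v₃) ×-dec rainbow? (c v₁) (c v₂) (c v₃)

  rainbow-3-AP : {c : V Cyl → Fin 3} → RainbowAP c → HasRainbow3AP Cyl 3 c
  rainbow-3-AP (v₁ , v₂ , v₃ , d≡d , rainbow) =
    v₁ , v₂ , v₃ , cylinderDist v₁ v₂ , cylinder-distance v₁ v₂ , subst (Dist Cyl v₂ v₃) (sym d≡d) (cylinder-distance v₂ v₃) , rainbow

-- The cycle C_(4k+2)

module CycleOf4k+2 (k : ℕ) where

  open CycleDistance (suc (4 * k)) public

  K : ℕ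
  K = suc (2 * k)

  n≡K+K : n ≡ K + K
  n≡K+K = lemma k
    where
      lemma : ∀ k → 2 + 4 * k ≡ suc (2 * k) + suc (2 * k)
      lemma = solve-∀

  K-odd : K ≡ suc (k + k)
  K-odd = cong (λ u → suc (k + u)) (+-identityʳ k)

  K<n : K < n
  K<n = subst (K <_) (sym n≡K+K) (m<m+n K z<s)

  n≡1+K+2k : n ≡ suc K + 2 * k
  n≡1+K+2k = lemma k
    where
      lemma : ∀ k → 2 + 4 * k ≡ suc (suc (2 * k)) + 2 * k
      lemma = solve-∀

  n∸K≡K : n ∸ K ≡ K
  n∸K≡K = trans (cong (_∸ K) n≡K+K) (m+n∸n≡m K K)

  ‖‖-small : ∀ {t} → t ≤ K → ‖ t ‖ ≡ t
  ‖‖-small {t} t≤K = begin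
    (t % n) ⊓ (n ∸ t % n)   ≡⟨ cong (λ r → r ⊓ (n ∸ r)) (m<n⇒m%n≡m t<n) ⟩
    t ⊓ (n ∸ t)             ≡⟨ m≤n⇒m⊓n≡m (m+n≤o⇒m≤o∸n t (≤-trans (+-mono-≤ t≤K t≤K) (≤-reflexive (sym n≡K+K)))) ⟩
    t                       ∎
    where
      open ≡-Reasoning
      t<n : t < n
      t<n = ≤-<-trans t≤K K<n

  ‖‖-large : ∀ {t} → K ≤ t → t < n → ‖ t ‖ ≡ n ∸ t
  ‖‖-large {t} K≤t t<n = begin
    (t % n) ⊓ (n ∸ t % n)   ≡⟨ cong (λ r → r ⊓ (n ∸ r)) (m<n⇒m%n≡m t<n) ⟩
    t ⊓ (n ∸ t)             ≡⟨ m≥n⇒m⊓n≡n (m≤n+o⇒m∸n≤o n t (≤-trans (≤-reflexive n≡K+K) (+-mono-≤ K≤t K≤t))) ⟩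
    n ∸ t                   ∎
    where open ≡-Reasoning

  ‖n∸t‖≡t : ∀ {t} → 0 < t → t ≤ K → ‖ n ∸ t ‖ ≡ t
  ‖n∸t‖≡t {t} 0<t t≤K = trans (‖‖-large K≤n∸t (∸-monoʳ-< 0<t t≤n)) (m∸[m∸n]≡n t≤n)
    where
      t≤n : t ≤ n
      t≤n = ≤-trans t≤K (<⇒≤ K<n)
      K≤n∸t : K ≤ n ∸ t
      K≤n∸t = subst (_≤ n ∸ t) n∸K≡K (∸-monoʳ-≤ n t≤K)

  towards : ∀ x y → ∃ λ σ → ∃ λ t → t ≤ K × (x + shift σ t) % n ≡ y % n
  towards x y with offset-to x y
  ... | o , o≤n , x+o≡y with o ≤? K
  ...   | yes o≤K = true , o , o≤K , x+o≡y
  ...   | no o≰K = false , n ∸ o , n∸o≤K , subst (λ z → (x + z) % n ≡ y % n) (sym (m∸[m∸n]≡n o≤n)) x+o≡y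
    where
      n∸o≤K : n ∸ o ≤ K
      n∸o≤K = m≤n+o⇒m∸n≤o n o (subst (_≤ o + K) (sym n≡K+K) (+-monoˡ-≤ K (<⇒≤ (≰⇒> o≰K))))

-- Rainbow-free 3-colourings of P_m □ C_(4k+2)

module RainbowFreeColouring (m₀ k : ℕ) (c : V (P (suc m₀) □ C (2 + 4 * k)) → Fin 3)
  (rainbow-free : ¬ CylinderDistance.RainbowAP (suc m₀) (suc (4 * k)) c) where

  open CycleOf4k+2 k
  open CylinderDistance (suc m₀) (suc (4 * k)) using (cylinderDist)

  m : ℕ
  m = suc m₀

  -- both coordinates are reduced (modulo m and n), so col is total; rows ≥ m never occur below
  vertex : ℕ → ℕ → V (P m □ C n)
  vertex a x = fromℕ< (m%n<n a m) , fromℕ< (m%n<n x n)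

  col : ℕ → ℕ → Fin 3
  col a x = c (vertex a x)

  col-mod : ∀ a x y → x % n ≡ y % n → col a x ≡ col a y
  col-mod a x y x≡y = cong (λ z → c (fromℕ< (m%n<n a m) , z))
    (toℕ-injective (trans (toℕ-fromℕ< (m%n<n x n)) (trans x≡y (sym (toℕ-fromℕ< (m%n<n y n))))))

  col-% : ∀ a x → col a (x % n) ≡ col a x
  col-% a x = col-mod a (x % n) x (m%n%n≡m%n x n)

  cylinderDist-vertex : ∀ {a b} x y → a < m → b < m →
                        cylinderDist (vertex a x) (vertex b y) ≡ ∣ a - b ∣ + cycleDist (x % n) (y % n)
  cylinderDist-vertex {a} {b} x y a<m b<m
    rewrite toℕ-fromℕ< (m%n<n a m) | toℕ-fromℕ< (m%n<n b m) | toℕ-fromℕ< (m%n<n x n) | toℕ-fromℕ< (m%n<n y n)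
          | m<n⇒m%n≡m a<m | m<n⇒m%n≡m b<m = refl

  -- cells addressed by a row offset α and a column offset s from (b , x), the column offsets
  -- running clockwise (σ = true) or anticlockwise (σ = false)
  module Frame (b x : ℕ) (σ : Bool) where

    Point : Set
    Point = ℕ × ℕ

    vertexAt : Point → V (P m □ C n)
    vertexAt (α , s) = vertex (b + α) (x + shift σ s)

    colour : Point → Fin 3
    colour p = c (vertexAt p)

    apart : Point → Point → ℕ
    apart (α , s) (β , s′) = ∣ α - β ∣ + ‖ ∣ s - s′ ∣ ‖

    Inside : Point → Set
    Inside (α , s) = b + α < m × s ≤ n

    apart-dist : ∀ p q → Inside p → Inside q → cylinderDist (vertexAt p) (vertexAt q) ≡ apart p q
    apart-dist (α , s) (β , s′) (α< , s≤n) (β< , s′≤n) = begin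
      cylinderDist (vertex (b + α) (x + shift σ s)) (vertex (b + β) (x + shift σ s′))
        ≡⟨ cylinderDist-vertex (x + shift σ s) (x + shift σ s′) α< β< ⟩
      ∣ b + α - b + β ∣ + cycleDist ((x + shift σ s) % n) ((x + shift σ s′) % n)
        ≡⟨ cong₂ _+_ (∣m+n-m+o∣≡∣n-o∣ b α β) (cycleDist-offsets x (shift σ s) (shift σ s′)) ⟩
      ∣ α - β ∣ + ‖ ∣ shift σ s - shift σ s′ ∣ ‖
        ≡⟨ cong (λ d → ∣ α - β ∣ + ‖ d ‖) (∣shift-shift∣ σ s≤n s′≤n) ⟩
      ∣ α - β ∣ + ‖ ∣ s - s′ ∣ ‖ ∎
      where open ≡-Reasoning

    no-rainbow-AP : ∀ {c₁ c₂ c₃} p q r → Inside p → Inside q → Inside r → apart p q ≡ apart q r →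
                    colour p ≡ c₁ → colour q ≡ c₂ → colour r ≡ c₃ → ¬ Rainbow c₁ c₂ c₃
    no-rainbow-AP p q r ip iq ir pq≡qr refl refl refl rainbow =
      rainbow-free (vertexAt p , vertexAt q , vertexAt r , trans (apart-dist p q ip iq) (trans pq≡qr (sym (apart-dist q r iq ir))) , rainbow)


  module BandGap (a : ℕ) (a+1<m : a + 1 < m) (j h : ℕ) (j+H<n : j + (2 + h) < n)
                 {p q r : Fin 3} (pqr : Rainbow p q r)
                 (between : ∀ α o → α ≤ 1 → 0 < o → o < 2 + h → col (a + α) (j + o) ≡ q) where

    open Frame a j true public

    H : ℕ
    H = 2 + h

    H<n : H < n
    H<n = ≤-<-trans (m≤n+m H j) j+H<n

    inside : ∀ {α o} → α ≤ 1 → o ≤ n → Inside (α , o)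
    inside α≤1 o≤n = ≤-<-trans (+-monoʳ-≤ a α≤1) a+1<m , o≤n

    inside-H : ∀ {α} → α ≤ 1 → Inside (α , H)
    inside-H α≤1 = inside α≤1 (<⇒≤ H<n)

    q-at : ∀ {α o} → α ≤ 1 → 0 < o → o < H → colour (α , o) ≡ q
    q-at {α} {o} = between α o

    around-H : H ≤ K → ‖ ∣ H - n ∣ ‖ ≡ H
    around-H H≤K = trans (cong ‖_‖ (m≤n⇒∣m-n∣≡n∸m (<⇒≤ H<n))) (‖n∸t‖≡t z<s H≤K)

    back-past-H : suc H ≤ K → ‖ ∣ n ∸ 1 - H ∣ ‖ ≡ suc H
    back-past-H H<K = trans (cong ‖_‖ (m≤n⇒∣n-m∣≡n∸m (s≤s⁻¹ H<n))) (‖n∸t‖≡t z<s H<K)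

    even-below-K : ∀ s → H ≡ s + s → H ≤ K → suc H ≤ K
    even-below-K s H≡ H≤K with m≤n⇒m<n∨m≡n H≤K
    ... | inj₁ H<K = H<K
    ... | inj₂ H≡K = ⊥-elim (s+s≢1+t+t s k (trans (sym H≡) (trans H≡K K-odd)))

    halfway : ∀ {α c₁ c₃} → α ≤ 1 → ∀ s → H ≡ s + s → colour (α , 0) ≡ c₁ → colour (α , H) ≡ c₃ → ¬ Rainbow c₁ q c₃
    halfway {α} α≤1 s H≡ at-0 at-H =
      no-rainbow-AP (α , 0) (α , s) (α , H) (inside α≤1 z≤n) (inside α≤1 (<⇒≤ (<-trans s<H H<n))) (inside-H α≤1)
                    eq at-0 (q-at α≤1 0<s s<H) at-H
      where
        0<s : 0 < s
        0<s = half-pos (subst (0 <_) H≡ z<s)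
        s<H : s < H
        s<H = subst (s <_) (sym H≡) (m<m+n s 0<s)
        eq : ∣ α - α ∣ + ‖ s ‖ ≡ ∣ α - α ∣ + ‖ ∣ s - H ∣ ‖
        eq = cong (λ d → ∣ α - α ∣ + ‖ d ‖) (sym (trans (cong (∣ s -_∣) H≡) (∣m-m+n∣≡n s s)))

    long-gap : ∀ {ρ ρ′} → ρ ≤ 1 → ρ′ ≤ 1 → colour (ρ , 0) ≡ p → colour (ρ′ , H) ≡ r → K < H → ⊥
    long-gap {ρ} {ρ′} ρ≤1 ρ′≤1 at-p at-r K<H =
      no-rainbow-AP (ρ′ , n ∸ H) (ρ , 0) (ρ′ , H) (inside ρ′≤1 (m∸n≤m n H)) (inside ρ≤1 z≤n) (inside-H ρ′≤1)
                    eq (q-at ρ′≤1 (m<n⇒0<n∸m H<n) n∸H<H) at-p at-r (rainbow-swap₁₂ pqr)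
      where
        n<H+H : n < H + H
        n<H+H = subst (_< H + H) (sym n≡K+K) (+-mono-< K<H K<H)
        n∸H<H : n ∸ H < H
        n∸H<H = m<n+o⇒m∸n<o n H n<H+H
        n∸H≤K : n ∸ H ≤ K
        n∸H≤K = m≤n+o⇒m∸n≤o n H (subst (n ≤_) (+-comm K H) (subst (_≤ K + H) (sym n≡K+K) (+-monoʳ-≤ K (<⇒≤ K<H))))
        eq : ∣ ρ′ - ρ ∣ + ‖ ∣ n ∸ H - 0 ∣ ‖ ≡ ∣ ρ - ρ′ ∣ + ‖ H ‖
        eq = cong₂ _+_ (∣-∣-comm ρ′ ρ) (begin
          ‖ ∣ n ∸ H - 0 ∣ ‖   ≡⟨ cong ‖_‖ (∣-∣-identityʳ (n ∸ H)) ⟩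
          ‖ n ∸ H ‖           ≡⟨ ‖‖-small n∸H≤K ⟩
          n ∸ H               ≡⟨ ‖‖-large (<⇒≤ K<H) H<n ⟨
          ‖ H ‖               ∎)
          where open ≡-Reasoning

    module Rows {ρ ρ′ : ℕ} (ρ≤1 : ρ ≤ 1) (ρ′≤1 : ρ′ ≤ 1) (ρρ′ : ∣ ρ - ρ′ ∣ ≡ 1) (at-p : colour (ρ , 0) ≡ p) where

      ρ′ρ : ∣ ρ′ - ρ ∣ ≡ 1
      ρ′ρ = trans (∣-∣-comm ρ′ ρ) ρρ′

      same-row : colour (ρ , H) ≡ r → H ≤ K → ⊥
      same-row at-r H≤K with even-or-odd H
      ... | inj₁ (s , H≡) = halfway ρ≤1 s H≡ at-p at-r pqr
      ... | inj₂ (s , H≡) =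
            no-rainbow-AP (ρ′ , s + s) (ρ , 0) (ρ , H) (inside ρ′≤1 (≤-trans 2s≤K (<⇒≤ K<n))) (inside ρ≤1 z≤n) (inside-H ρ≤1)
                          eq (q-at ρ′≤1 0<2s 2s<H) at-p at-r (rainbow-swap₁₂ pqr)
        where
          0<2s : 0 < s + s
          0<2s = s≤s⁻¹ (subst (2 ≤_) H≡ (s≤s (s≤s z≤n)))
          2s<H : s + s < H
          2s<H = subst (s + s <_) (sym H≡) (n<1+n (s + s))
          2s≤K : s + s ≤ K
          2s≤K = ≤-trans (<⇒≤ 2s<H) H≤K
          eq : ∣ ρ′ - ρ ∣ + ‖ ∣ s + s - 0 ∣ ‖ ≡ ∣ ρ - ρ ∣ + ‖ H ‖
          eq = begin
            ∣ ρ′ - ρ ∣ + ‖ ∣ s + s - 0 ∣ ‖   ≡⟨ cong₂ _+_ ρ′ρ (trans (cong ‖_‖ (∣-∣-identityʳ (s + s))) (‖‖-small 2s≤K)) ⟩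
            suc (s + s)                       ≡⟨ H≡ ⟨
            H                                 ≡⟨ ‖‖-small H≤K ⟨
            ‖ H ‖                             ≡⟨ cong (_+ ‖ H ‖) (∣n-n∣≡0 ρ) ⟨
            ∣ ρ - ρ ∣ + ‖ H ‖                 ∎
            where open ≡-Reasoning

      -- H is even and K odd, so H < K and column n − 1 (just before j) is at distance H + 1 from column H
      even-opposite : ∀ s → H ≡ s + s → suc H ≤ K → colour (ρ′ , H) ≡ r → ⊥
      even-opposite s H≡ H<K at-r with rainbow-covers pqr (colour (ρ′ , 0))
      ... | inj₁ at-p′ = halfway ρ′≤1 s H≡ at-p′ at-r pqr
      ... | inj₂ (inj₂ at-r′) =
            no-rainbow-AP (ρ′ , 0) (ρ , 0) (ρ , 1) (inside ρ′≤1 z≤n) (inside ρ≤1 z≤n) (inside ρ≤1 (s≤s z≤n))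
                          (trans (cong (_+ 0) ρ′ρ) (cong (_+ 1) (sym (∣n-n∣≡0 ρ)))) at-r′ at-p (q-at ρ≤1 z<s (s≤s (s≤s z≤n)))
                          (rainbow-rotate (rainbow-rotate pqr))
      ... | inj₂ (inj₁ at-q′) with rainbow-covers pqr (colour (ρ , H))
      ...   | inj₂ (inj₂ at-rH) = halfway ρ≤1 s H≡ at-p at-rH pqr
      ...   | inj₁ at-pH =
              no-rainbow-AP (ρ′ , H) (ρ , H) (ρ , H ∸ 1) (inside-H ρ′≤1) (inside-H ρ≤1) (inside ρ≤1 (≤-trans (n≤1+n _) (<⇒≤ H<n)))
                            eq at-r at-pH (q-at ρ≤1 z<s (n<1+n _)) (rainbow-rotate (rainbow-rotate pqr))
        where
          eq : ∣ ρ′ - ρ ∣ + ‖ ∣ H - H ∣ ‖ ≡ ∣ ρ - ρ ∣ + ‖ ∣ H - H ∸ 1 ∣ ‖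
          eq = trans (cong₂ (λ d e → d + ‖ e ‖) ρ′ρ (∣n-n∣≡0 H))
                     (sym (cong₂ (λ d e → d + ‖ e ‖) (∣n-n∣≡0 ρ) (trans (∣-∣-comm (suc h) h) (∣n-d+n∣≡d 1 h))))
      ...   | inj₂ (inj₁ at-qH) with rainbow-covers pqr (colour (ρ′ , n ∸ 1))
      ...     | inj₁ at-p″ =
                no-rainbow-AP (ρ , H ∸ 1) (ρ′ , n ∸ 1) (ρ′ , H) (inside ρ≤1 (≤-trans (n≤1+n _) (<⇒≤ H<n))) (inside ρ′≤1 (n≤1+n _)) (inside-H ρ′≤1)
                              (trans (cong₂ _+_ ρρ′ (around-H (<⇒≤ H<K))) (sym (trans (cong (_+ _) (∣n-n∣≡0 ρ′)) (back-past-H H<K))))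
                              (q-at ρ≤1 z<s (n<1+n _)) at-p″ at-r (rainbow-swap₁₂ pqr)
      ...     | inj₂ (inj₁ at-q″) =
                no-rainbow-AP (ρ′ , n ∸ 1) (ρ′ , H) (ρ , 0) (inside ρ′≤1 (n≤1+n _)) (inside-H ρ′≤1) (inside ρ≤1 z≤n)
                              (trans (cong (_+ _) (∣n-n∣≡0 ρ′)) (trans (back-past-H H<K) (sym (cong₂ _+_ ρ′ρ (‖‖-small (<⇒≤ H<K))))))
                              at-q″ at-r at-p (rainbow-rotate pqr)
      ...     | inj₂ (inj₂ at-r″) =
                no-rainbow-AP (ρ′ , n ∸ 1) (ρ′ , 0) (ρ , 0) (inside ρ′≤1 (n≤1+n _)) (inside ρ′≤1 z≤n) (inside ρ≤1 z≤n)
                              (trans (cong₂ _+_ (∣n-n∣≡0 ρ′) (‖n∸t‖≡t z<s (s≤s z≤n))) (sym (cong (_+ 0) ρ′ρ)))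
                              at-r″ at-q′ at-p (rainbow-reverse pqr)

      opposite-rows : colour (ρ′ , H) ≡ r → H ≤ K → ⊥
      opposite-rows at-r H≤K with even-or-odd H
      ... | inj₁ (s , H≡) = even-opposite s H≡ (even-below-K s H≡ H≤K) at-r
      ... | inj₂ (s , H≡) =
            no-rainbow-AP (ρ , 0) (ρ′ , s) (ρ′ , H) (inside ρ≤1 z≤n) (inside ρ′≤1 (≤-trans s≤K (<⇒≤ K<n))) (inside-H ρ′≤1)
                          eq at-p (q-at ρ′≤1 0<s s<H) at-r pqr
        where
          H≡′ : H ≡ s + suc s
          H≡′ = trans H≡ (sym (+-suc s s))
          0<s : 0 < s
          0<s = half-pos (s≤s⁻¹ (subst (2 ≤_) H≡ (s≤s (s≤s z≤n))))
          s<H : s < H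
          s<H = subst (s <_) (sym H≡′) (m<m+n s z<s)
          s≤K : s ≤ K
          s≤K = ≤-trans (<⇒≤ s<H) H≤K
          eq : ∣ ρ - ρ′ ∣ + ‖ s ‖ ≡ ∣ ρ′ - ρ′ ∣ + ‖ ∣ s - H ∣ ‖
          eq = begin
            ∣ ρ - ρ′ ∣ + ‖ s ‖        ≡⟨ cong₂ _+_ ρρ′ (‖‖-small s≤K) ⟩
            suc s                      ≡⟨ ‖‖-small (≤-trans (subst (suc s ≤_) (sym H≡′) (m≤n+m (suc s) s)) H≤K) ⟨
            ‖ suc s ‖                  ≡⟨ cong ‖_‖ (trans (cong (∣ s -_∣) H≡′) (∣m-m+n∣≡n s (suc s))) ⟨
            ‖ ∣ s - H ∣ ‖              ≡⟨ cong (_+ ‖ ∣ s - H ∣ ‖) (∣n-n∣≡0 ρ′) ⟨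
            ∣ ρ′ - ρ′ ∣ + ‖ ∣ s - H ∣ ‖ ∎
            where open ≡-Reasoning

  InRow : ℕ → Fin 3 → Set
  InRow a c = ∃ λ x → col a x ≡ c

  module Band (a : ℕ) (a+1<m : a + 1 < m) where

    BandSlot : ℕ → Fin 3 → Set
    BandSlot x c = col (a + 0) x ≡ c ⊎ col (a + 1) x ≡ c

    open Gaps BandSlot

    unit-square : ∀ t → suc t < n → ∀ {x y z} → Rainbow x y z → InPair t x → InPair t y → ¬ InPair t z
    unit-square t t+1<n = no-rainbow-subtriple⇒dichromatic (colour (0 , t)) (colour (1 , t)) (colour (0 , suc t)) (colour (1 , suc t))
      (λ wxy → no-rainbow-AP (1 , t) (0 , t) (0 , suc t) (in₁ t<n) (in₀ t<n) (in₀ t+1<n) across refl refl refl (rainbow-swap₁₂ wxy))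
      (no-rainbow-AP (0 , t) (1 , t) (1 , suc t) (in₀ t<n) (in₁ t<n) (in₁ t+1<n) across refl refl refl)
      (no-rainbow-AP (0 , t) (0 , suc t) (1 , suc t) (in₀ t<n) (in₀ t+1<n) (in₁ t+1<n) (sym across) refl refl refl)
      (λ xyz → no-rainbow-AP (1 , t) (1 , suc t) (0 , suc t) (in₁ t<n) (in₁ t+1<n) (in₀ t+1<n) (sym across) refl refl refl (rainbow-swap₂₃ xyz))
      where
        open Frame a 0 true
        t<n : t < n
        t<n = <-trans (n<1+n t) t+1<n
        in₀ : ∀ {o} → o < n → Inside (0 , o)
        in₀ o<n = ≤-<-trans (+-monoʳ-≤ a z≤n) a+1<m , <⇒≤ o<n
        in₁ : ∀ {o} → o < n → Inside (1 , o)
        in₁ o<n = a+1<m , <⇒≤ o<n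
        across : 1 + ‖ ∣ t - t ∣ ‖ ≡ 0 + ‖ ∣ t - suc t ∣ ‖
        across rewrite ∣n-n∣≡0 t | ∣n-d+n∣≡d 1 t = refl

    row-of : ∀ {x c} → BandSlot x c → ∃ λ ρ → ρ ≤ 1 × col (a + ρ) x ≡ c
    row-of (inj₁ e) = 0 , z≤n , e
    row-of (inj₂ e) = 1 , ≤-refl , e

    gap-impossible : Gap n → ⊥
    gap-impossible record { start = j ; width = suc (suc h) ; left = p ; middle = q ; right = r ; rainbow = pqr
                          ; wide = s≤s (s≤s z≤n) ; fits = fits ; at-start = at-p ; at-end = at-r ; inside = inside }
      = split (K <? 2 + h) at-p at-r
      where
        between : ∀ α o → α ≤ 1 → 0 < o → o < 2 + h → col (a + α) (j + o) ≡ q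
        between zero o _ 0<o o<H = inside (j + o) _ (m<m+n j 0<o) (+-monoʳ-< j o<H) (inj₁ refl)
        between (suc zero) o _ 0<o o<H = inside (j + o) _ (m<m+n j 0<o) (+-monoʳ-< j o<H) (inj₂ refl)
        between (suc (suc _)) _ (s≤s ())

        open BandGap a a+1<m j h fits pqr between

        start : ∀ {ρ} → col (a + ρ) j ≡ p → colour (ρ , 0) ≡ p
        start {ρ} = trans (cong (col (a + ρ)) (+-identityʳ j))

        split : Dec (K < H) → BandSlot j p → BandSlot (j + H) r → ⊥
        split (yes K<H) at-p at-r with row-of {j} at-p | row-of {j + H} at-r
        ... | _ , ρ≤1 , e | _ , ρ′≤1 , e′ = long-gap ρ≤1 ρ′≤1 (start e) e′ K<H
        split (no K≮H) (inj₁ e) (inj₁ e′) = Rows.same-row {0} {1} z≤n ≤-refl refl (start e) e′ (≮⇒≥ K≮H)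
        split (no K≮H) (inj₁ e) (inj₂ e′) = Rows.opposite-rows {0} {1} z≤n ≤-refl refl (start e) e′ (≮⇒≥ K≮H)
        split (no K≮H) (inj₂ e) (inj₁ e′) = Rows.opposite-rows {1} {0} ≤-refl z≤n refl (start e) e′ (≮⇒≥ K≮H)
        split (no K≮H) (inj₂ e) (inj₂ e′) = Rows.same-row {1} {0} ≤-refl z≤n refl (start e) e′ (≮⇒≥ K≮H)

  band-dichromatic : ∀ a → suc a < m → ∀ {x y z} → Rainbow x y z →
                     InRow a x ⊎ InRow (suc a) x → InRow a y ⊎ InRow (suc a) y → ¬ (InRow a z ⊎ InRow (suc a) z)
  band-dichromatic a a+1<m xyz ix iy iz =
    rainbow-sequence-has-gap n (s≤s (s≤s z≤n)) (λ t _ → col (a + 0) t , inj₁ refl) unit-square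
                             xyz (seen ix) (seen iy) (seen iz) gap-impossible
    where
      open Band a (subst (_< m) (+-comm 1 a) a+1<m)
      open Gaps BandSlot
      seen : ∀ {c} → InRow a c ⊎ InRow (suc a) c → SeenBelow n c
      seen (inj₁ (x , e)) = x % n , m%n<n x n , inj₁ (trans (cong (λ b → col b (x % n)) (+-identityʳ a)) (trans (col-% a x) e))
      seen (inj₂ (x , e)) = x % n , m%n<n x n , inj₂ (trans (cong (λ b → col b (x % n)) (+-comm a 1)) (trans (col-% (suc a) x) e))

  module ShiftedRowGap (j₀ x : ℕ) (σ : Bool) (h : ℕ) (rows : j₀ + (3 + h) < m) {p q r : Fin 3} (pqr : Rainbow p q r)
                       (at-p : Frame.colour j₀ x σ (1 , 0) ≡ p) (at-r : Frame.colour j₀ x σ (3 + h , K) ≡ r)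
                       (between : ∀ α s → 1 < α → α < 3 + h → Frame.colour j₀ x σ (α , s) ≡ q) where

    open Frame j₀ x σ

    H : ℕ
    H = 2 + h

    inside : ∀ {α s} → α ≤ suc H → s ≤ n → Inside (α , s)
    inside α≤ s≤n = ≤-<-trans (+-monoʳ-≤ j₀ α≤) rows , s≤n

    far-corner : H + ‖ K ‖ ≡ suc H + ‖ 2 * k ‖
    far-corner = begin
      H + ‖ K ‖              ≡⟨ cong (H +_) (‖‖-small ≤-refl) ⟩
      H + K                  ≡⟨ +-suc H (2 * k) ⟩
      suc H + 2 * k          ≡⟨ cong (suc H +_) (‖‖-small (n≤1+n _)) ⟨
      suc H + ‖ 2 * k ‖      ∎
      where open ≡-Reasoning

    impossible : ⊥
    impossible with rainbow-covers pqr (colour (0 , 1))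
    ... | inj₁ at-p′ =
          no-rainbow-AP (H , suc K) (0 , 1) (suc H , K) (inside (n≤1+n H) K<n) (inside z≤n (s≤s z≤n)) (inside ≤-refl (<⇒≤ K<n))
                        far-corner (between H (suc K) (s≤s (s≤s z≤n)) (n<1+n H)) at-p′ at-r (rainbow-swap₁₂ pqr)
    ... | inj₂ (inj₁ at-q′) =
          no-rainbow-AP (0 , 1) (suc H , K) (1 , 0) (inside z≤n (s≤s z≤n)) (inside ≤-refl (<⇒≤ K<n)) (inside (s≤s z≤n) z≤n)
                        (sym far-corner) at-q′ at-r at-p (rainbow-rotate pqr)
    ... | inj₂ (inj₂ at-r′) =
          no-rainbow-AP (1 , 0) (2 , 1) (0 , 1) (inside (s≤s z≤n) z≤n) (inside (s≤s (s≤s z≤n)) (s≤s z≤n)) (inside z≤n (s≤s z≤n))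
                        refl at-p (between 2 1 ≤-refl (s≤s (s≤s (s≤s z≤n)))) at-r′ pqr

  module RowGap (j x : ℕ) (σ : Bool) (h t : ℕ) (t≤K : t ≤ K) (rows : j + (2 + h) < m) {p q r : Fin 3} (pqr : Rainbow p q r)
                (at-p : Frame.colour j x σ (0 , 0) ≡ p) (at-r : Frame.colour j x σ (2 + h , t) ≡ r)
                (between : ∀ α s → 0 < α → α < 2 + h → Frame.colour j x σ (α , s) ≡ q) where

    open Frame j x σ

    H : ℕ
    H = 2 + h

    inside : ∀ {α s} → α ≤ H → s ≤ K → Inside (α , s)
    inside α≤H s≤K = ≤-<-trans (+-monoʳ-≤ j α≤H) rows , ≤-trans s≤K (<⇒≤ K<n)

    both-even : ∀ s τ → H ≡ s + s → t ≡ τ + τ → ⊥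
    both-even s τ H≡ t≡ =
      no-rainbow-AP (0 , 0) (s , τ) (H , t) (inside z≤n z≤n) (inside (<⇒≤ s<H) (≤-trans τ≤t t≤K)) (inside ≤-refl t≤K)
                    eq at-p (between s τ 0<s s<H) at-r pqr
      where
        0<s : 0 < s
        0<s = half-pos (subst (0 <_) H≡ z<s)
        s<H : s < H
        s<H = subst (s <_) (sym H≡) (m<m+n s 0<s)
        τ≤t : τ ≤ t
        τ≤t = subst (τ ≤_) (sym t≡) (m≤m+n τ τ)
        eq : s + ‖ τ ‖ ≡ ∣ s - H ∣ + ‖ ∣ τ - t ∣ ‖
        eq = sym (cong₂ (λ d e → d + ‖ e ‖) (trans (cong (∣ s -_∣) H≡) (∣m-m+n∣≡n s s))
                                             (trans (cong (∣ τ -_∣) t≡) (∣m-m+n∣≡n τ τ)))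

    both-odd : ∀ s τ → H ≡ suc (s + s) → t ≡ suc (τ + τ) → ⊥
    both-odd s τ H≡ t≡ =
      no-rainbow-AP (0 , 0) (s , suc τ) (H , t) (inside z≤n z≤n) (inside (<⇒≤ s<H) 1+τ≤K) (inside ≤-refl t≤K)
                    eq at-p (between s (suc τ) 0<s s<H) at-r pqr
      where
        0<s : 0 < s
        0<s = half-pos (s≤s⁻¹ (subst (2 ≤_) H≡ (s≤s (s≤s z≤n))))
        s<H : s < H
        s<H = subst (s <_) (sym H≡) (s≤s (m≤m+n s s))
        1+τ≤K : suc τ ≤ K
        1+τ≤K = ≤-trans (subst (suc τ ≤_) (sym t≡) (s≤s (m≤m+n τ τ))) t≤K
        eq : s + ‖ suc τ ‖ ≡ ∣ s - H ∣ + ‖ ∣ suc τ - t ∣ ‖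
        eq = begin
          s + ‖ suc τ ‖                ≡⟨ cong (s +_) (‖‖-small 1+τ≤K) ⟩
          s + suc τ                    ≡⟨ +-suc s τ ⟩
          suc s + τ                    ≡⟨ cong₂ _+_ (trans (cong (∣ s -_∣) (trans H≡ (sym (+-suc s s)))) (∣m-m+n∣≡n s (suc s)))
                                                    (trans (cong (λ u → ‖ ∣ suc τ - u ∣ ‖) t≡) (trans (cong ‖_‖ (∣m-m+n∣≡n τ τ)) (‖‖-small (≤-trans (n≤1+n τ) 1+τ≤K)))) ⟨
          ∣ s - H ∣ + ‖ ∣ suc τ - t ∣ ‖ ∎
          where open ≡-Reasoning

    mixed : suc t ≤ K → ⊥
    mixed 1+t≤K =
      no-rainbow-AP (suc h , suc t) (0 , 0) (H , t) (inside (n≤1+n _) 1+t≤K) (inside z≤n z≤n) (inside ≤-refl t≤K)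
                    eq (between (suc h) (suc t) z<s (n<1+n _)) at-p at-r (rainbow-swap₁₂ pqr)
      where
        eq : suc h + ‖ suc t ‖ ≡ H + ‖ t ‖
        eq = trans (cong (suc h +_) (‖‖-small 1+t≤K)) (trans (+-suc (suc h) t) (cong (H +_) (sym (‖‖-small t≤K))))

    module _ (at-r : colour (H , K) ≡ r) where

      corner-above : ∀ {j₀} → j ≡ suc j₀ → ⊥
      corner-above {j₀} j≡ = ShiftedRowGap.impossible j₀ x σ h rows′ pqr (trans (rebase 0 0) at-p)
                                                      (trans (rebase H K) at-r) between′
        where
          rebase : ∀ α s → Frame.colour j₀ x σ (suc α , s) ≡ colour (α , s)
          rebase α s = cong (λ b → col b (x + shift σ s)) (trans (+-suc j₀ α) (cong (_+ α) (sym j≡)))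
          rows′ : j₀ + (3 + h) < m
          rows′ = subst (_< m) (trans (cong (_+ H) j≡) (sym (+-suc j₀ H))) rows
          between′ : ∀ α s → 1 < α → α < 3 + h → Frame.colour j₀ x σ (α , s) ≡ q
          between′ (suc α) s 1<α α< = trans (rebase α s) (between α s (s≤s⁻¹ 1<α) (s≤s⁻¹ α<))

      module _ (k≥1 : 1 ≤ k) where

        ‖1+K‖ : ‖ suc K ‖ ≡ 2 * k
        ‖1+K‖ = trans (‖‖-large (n≤1+n K) 1+K<n) (trans (cong (_∸ suc K) n≡1+K+2k) (m+n∸m≡n (suc K) (2 * k)))
          where
            1+K<n : suc K < n
            1+K<n = subst (suc K <_) (sym n≡1+K+2k) (m<m+n (suc K) (≤-trans k≥1 (m≤m+n k (k + 0))))

        corner : H + ‖ K ‖ ≡ suc H + ‖ suc K ‖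
        corner = begin
          H + ‖ K ‖            ≡⟨ cong (H +_) (‖‖-small ≤-refl) ⟩
          H + suc (2 * k)      ≡⟨ +-suc H (2 * k) ⟩
          suc H + 2 * k        ≡⟨ cong (suc H +_) ‖1+K‖ ⟨
          suc H + ‖ suc K ‖    ∎
          where open ≡-Reasoning

        corner-below : j + suc H < m → ⊥
        corner-below rows′ = by-colour (rainbow-covers pqr (colour (suc H , suc K)))
          where
            inside′ : ∀ {α s} → α ≤ suc H → s ≤ n → Inside (α , s)
            inside′ α≤ s≤n = ≤-<-trans (+-monoʳ-≤ j α≤) rows′ , s≤n

            by-colour : let c = colour (suc H , suc K) in c ≡ p ⊎ c ≡ q ⊎ c ≡ r → ⊥
            by-colour (inj₂ (inj₁ at-q′)) =
              no-rainbow-AP (H , K) (0 , 0) (suc H , suc K) (inside′ (n≤1+n H) (<⇒≤ K<n)) (inside′ z≤n z≤n) (inside′ ≤-refl K<n)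
                            corner at-r at-p at-q′ (rainbow-rotate (rainbow-rotate pqr))
            by-colour (inj₂ (inj₂ at-r′)) =
              no-rainbow-AP (1 , 1) (suc H , suc K) (0 , 0) (inside′ (s≤s z≤n) (s≤s z≤n)) (inside′ ≤-refl K<n) (inside′ z≤n z≤n)
                            corner (between 1 1 z<s (s≤s (s≤s z≤n))) at-r′ at-p (rainbow-rotate pqr)
            by-colour (inj₁ at-p′) =
              no-rainbow-AP (H , K) (suc h , suc K) (suc H , suc K) (inside′ (n≤1+n H) (<⇒≤ K<n)) (inside′ (≤-trans (n≤1+n _) (n≤1+n H)) K<n)
                            (inside′ ≤-refl K<n) eq at-r (between (suc h) (suc K) z<s (n<1+n _)) at-p′ (rainbow-reverse pqr)
              where
                eq : ∣ H - suc h ∣ + ‖ ∣ K - suc K ∣ ‖ ≡ ∣ suc h - suc H ∣ + ‖ ∣ suc K - suc K ∣ ‖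
                eq = trans (cong₂ (λ d e → d + ‖ e ‖) (trans (∣-∣-comm (suc h) h) (∣n-d+n∣≡d 1 h)) (∣n-d+n∣≡d 1 K))
                           (sym (cong₂ (λ d e → d + ‖ e ‖) (∣n-d+n∣≡d 2 h) (∣n-n∣≡0 (suc K))))

    -- r's column offset K is odd while H is even; an extra row above or below the gap is needed,
    -- and it exists because m is even
    beyond : 1 ≤ k → (∃ λ m′ → m ≡ m′ + m′) → ∀ s → H ≡ s + s → colour (H , K) ≡ r → ⊥
    beyond k≥1 (m′ , m≡) s H≡ at-rK with suc (j + H) <? m
    ... | yes below = corner-below at-rK k≥1 (subst (_< m) (sym (+-suc j H)) below)
    ... | no not-below = top-row j refl
      where
        top-row : ∀ i → j ≡ i → ⊥
        top-row (suc j₀) j≡ = corner-above at-rK j≡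
        top-row zero j≡ = s+s≢1+t+t m′ s (begin
          m′ + m′          ≡⟨ m≡ ⟨
          m                ≡⟨ ≤-antisym (≮⇒≥ not-below) rows ⟩
          suc (j + H)      ≡⟨ cong (λ i → suc (i + H)) j≡ ⟩
          suc H            ≡⟨ cong suc H≡ ⟩
          suc (s + s)      ∎)
          where open ≡-Reasoning

    impossible : 1 ≤ k → (∃ λ m′ → m ≡ m′ + m′) → ⊥
    impossible k≥1 m-even with even-or-odd H | even-or-odd t | m≤n⇒m<n∨m≡n t≤K
    ... | inj₁ (s , H≡) | inj₁ (τ , t≡) | _ = both-even s τ H≡ t≡
    ... | inj₂ (s , H≡) | inj₂ (τ , t≡) | _ = both-odd s τ H≡ t≡
    ... | _ | _ | inj₁ t<K = mixed t<K
    ... | inj₁ (s , H≡) | inj₂ _ | inj₂ t≡K = beyond k≥1 m-even s H≡ (subst (λ u → colour (H , u) ≡ r) t≡K at-r)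
    ... | inj₂ _ | inj₁ (τ , t≡) | inj₂ t≡K = s+s≢1+t+t τ k (trans (sym t≡) (trans t≡K K-odd))

  vertex-toℕ : ∀ (v : V (P m □ C n)) → vertex (toℕ (proj₁ v)) (toℕ (proj₂ v)) ≡ v
  vertex-toℕ (a , x) = cong₂ _,_ (fromℕ<-toℕ-% a) (fromℕ<-toℕ-% x)
    where
      fromℕ<-toℕ-% : ∀ {N} .{{_ : NonZero N}} (i : Fin N) → fromℕ< (m%n<n (toℕ i) N) ≡ i
      fromℕ<-toℕ-% {N} i = toℕ-injective (trans (toℕ-fromℕ< (m%n<n (toℕ i) N)) (m<n⇒m%n≡m (toℕ<n i)))

  not-surjective : 1 ≤ k → 2 ≤ m → (∃ λ m′ → m ≡ m′ + m′) → ¬ (∀ i → ∃ λ v → c v ≡ i)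
  not-surjective k≥1 2≤m m-even onto =
    rainbow-sequence-has-gap m 2≤m (λ t _ → col t 0 , 0 , refl) band-dichromatic
                             {0F} {1F} {2F} ((λ ()) , (λ ()) , (λ ())) (seen _) (seen _) (seen _) gap-impossible
    where
      open Gaps InRow

      seen : ∀ i → SeenBelow m i
      seen i with onto i
      ... | (a , x) , e = toℕ a , toℕ<n a , toℕ x , trans (cong c (vertex-toℕ (a , x))) e

      gap-impossible : Gap m → ⊥
      gap-impossible record { start = j ; width = suc (suc h) ; left = p ; middle = q ; right = r ; rainbow = pqr
                            ; wide = s≤s (s≤s z≤n) ; fits = fits ; at-start = x₁ , at-p ; at-end = x₂ , at-r ; inside = inside }
        with towards x₁ x₂
      ... | σ , t , t≤K , x₁→x₂ = RowGap.impossible j x₁ σ h t t≤K fits pqr at-p′ at-r′ between k≥1 m-even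
        where
          at-p′ : Frame.colour j x₁ σ (0 , 0) ≡ p
          at-p′ = trans (cong (λ b → col b (x₁ + shift σ 0)) (+-identityʳ j))
                        (trans (col-mod j (x₁ + shift σ 0) x₁ (from-origin σ)) at-p)
            where
              from-origin : ∀ σ → (x₁ + shift σ 0) % n ≡ x₁ % n
              from-origin true = cong (_% n) (+-identityʳ x₁)
              from-origin false = [m+n]%n≡m%n x₁ n
          at-r′ : Frame.colour j x₁ σ (2 + h , t) ≡ r
          at-r′ = trans (col-mod (j + (2 + h)) (x₁ + shift σ t) x₂ x₁→x₂) at-r
          between : ∀ α s → 0 < α → α < 2 + h → Frame.colour j x₁ σ (α , s) ≡ q
          between α s 0<α α<H = inside (j + α) _ (m<m+n j 0<α) (+-monoʳ-< j α<H) (x₁ + shift σ s , refl)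


cylinder-below-three : ∀ m₀ n₀ s → 1 ≤ s → s < 3 → ¬ EveryExactRainbow (P (suc m₀) □ C (suc (suc n₀))) s
cylinder-below-three m₀ n₀ 1 _ s<3 =
  fewer-than-three-colours (P (suc m₀) □ C (suc (suc n₀))) s<3 (λ _ → 0F) λ { 0F → (0F , 0F) , refl }
cylinder-below-three m₀ n₀ 2 _ s<3 =
  fewer-than-three-colours (P (suc m₀) □ C (suc (suc n₀))) s<3 (λ { (_ , 0F) → 0F ; _ → 1F })
                           λ { 0F → (0F , 0F) , refl ; 1F → (0F , 1F) , refl }
cylinder-below-three m₀ n₀ (suc (suc (suc _))) _ (s≤s (s≤s (s≤s ())))

cylinder-rainbow-AP : ∀ m₀ k → 1 ≤ k → 2 ≤ suc m₀ → (∃ λ m′ → suc m₀ ≡ m′ + m′) →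
                      EveryExactRainbow (P (suc m₀) □ C (2 + 4 * k)) 3
cylinder-rainbow-AP m₀ k k≥1 2≤m m-even c onto =
  rainbow-3-AP (decidable-stable (rainbowAP? c) λ no-AP → RainbowFreeColouring.not-surjective m₀ k c no-AP k≥1 2≤m m-even onto)
  where open CylinderDistance (suc m₀) (suc (4 * k))

lemma10 : ∀ (m k : ℕ) → 2 ≤ m → 2 ∣ m → 1 ≤ k → aw3≡ (P m □ C (4 * k + 2)) 3
lemma10 zero _ () _ _
lemma10 (suc m₀) k 2≤m (divides m′ m≡) k≥1 =
  subst (λ N → aw3≡ (P (suc m₀) □ C N) 3) (+-comm 2 (4 * k))
        (s≤s z≤n , cylinder-rainbow-AP m₀ k k≥1 2≤m (m′ , trans m≡ (m*2≡m+m m′)) , cylinder-below-three m₀ (4 * k))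
  where
    m*2≡m+m : ∀ a → a * 2 ≡ a + a
    m*2≡m+m = solve-∀
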